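{- Let $G$ be a finite simple graph with $n$ vertices. Then (1) $Z(G)=n-\gamma_{\rm gr}^Z(G)$; (2) $Z_{\dot\ell}(G)=n-\gamma_{\rm gr}(G)$; (3) $Z_-(G)=n-\gamma_{\rm gr}^t(G)$; (4) $Z_L(G)=n-\gamma_{\rm gr}^L(G)$.
   Context: $N(x)$ and $N[x]$ denote open and closed neighborhoods. Vertices are colored blue or white and a color change rule is applied repeatedly. Rules: (CCR-$Z$) if $y\in N(x)$ and all of $N[x]$ is blue except $y$, then $y$ turns blue; (CCR-$Z_{\dot\ell}$) if $y\in N[x]$ and all of $N[x]$ is blue except $y$, then $y$ turns blue ($y=x$ allowed); (CCR-$Z_-$) if $y\in N(x)$ and all of $N(x)$ is blue except $y$, then $y$ turns blue; (CCR-$Z_L$) either $x\ne y$ and the CCR-$Z_-$ force from $x$ to $y$ applies, or $x=y$ and the CCR-$Z_{\dot\ell}$ force from $x$ to $x$ applies. A set $B$ is a zero forcing set for a rule if starting with $B$ blue and applying the rule repeatedly turns every vertex blue; $Z(G),Z_{\dot\ell}(G),Z_-(G),Z_L(G)$ are the minimum sizes of zero forcing sets for CCR-$Z$, CCR-$Z_{\dot\ell}$, CCR-$Z_-$, CCR-$Z_L$ respectively. A sequence $(v_1,\ldots,v_k)$ of distinct vertices is a $Z$-sequence if $N(v_i)\setminus\bigcup_{j<i}N[v_j]\ne\emptyset$ for all $i$; a dominating sequence if $N[v_i]\setminus\bigcup_{j<i}N[v_j]\ne\emptyset$; a total dominating sequence if $N(v_i)\setminus\bigcup_{j<i}N(v_j)\ne\emptyset$;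 an $L$-sequence if $N[v_i]\setminus\bigcup_{j<i}N(v_j)\ne\emptyset$. $\gamma_{\rm gr}^Z(G),\gamma_{\rm gr}(G),\gamma_{\rm gr}^t(G),\gamma_{\rm gr}^L(G)$ are the maximum lengths of a $Z$-sequence, dominating sequence, total dominating sequence, and $L$-sequence, respectively. -}

module Defs where

open import Data.Nat using (ℕ; _≤_)
open import Data.Bool using (Bool; true)
open import Data.Fin using (Fin)
open import Data.Fin.Subset using (Subset; _∈_; ∣_∣)
open import Data.List using (List; []; _∷_; length)
open import Data.List.Membership.Propositional using () renaming (_∈_ to _∈ₗ_; _∉_ to _∉ₗ_)
open import Data.Product using (∃; _×_)
open import Data.Sum using (_⊎_)
open import Data.Unit using (⊤)
open import Relation.Nullary using (¬_)
open import Relation.Binary.PropositionalEquality using (_≡_; _≢_)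

record Graph (n : ℕ) : Set where
  field
    adj    : Fin n → Fin n → Bool
    sym    : ∀ x y → adj x y ≡ adj y x
    irrefl : ∀ x → ¬ (adj x x ≡ true)
open Graph public

module _ {n : ℕ} (G : Graph n) where

  N⟮_⟯ : Fin n → Fin n → Set
  N⟮ x ⟯ y = adj G x y ≡ true

  N[_] : Fin n → Fin n → Set
  N[ x ] y = (y ≡ x) ⊎ N⟮ x ⟯ y

  -- Color change rules.  Force R blue x y : "x forces y" when the
  -- currently blue vertices are those satisfying `blue`.
  data Rule : Set where
    CCR-Z CCR-Zdot CCR-Zminus CCR-ZL : Rule

  ForceZ ForceZdot ForceZminus : (Fin n → Set) → Fin n → Fin n → Set
  ForceZ blue x y = N⟮ x ⟯ y × (∀ w → N[ x ] w → w ≢ y → blue w)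
  ForceZdot blue x y = N[ x ] y × (∀ w → N[ x ] w → w ≢ y → blue w)
  ForceZminus blue x y = N⟮ x ⟯ y × (∀ w → N⟮ x ⟯ w → w ≢ y → blue w)

  Force : Rule → (Fin n → Set) → Fin n → Fin n → Set
  Force CCR-Z      blue x y = ForceZ blue x y
  Force CCR-Zdot   blue x y = ForceZdot blue x y
  Force CCR-Zminus blue x y = ForceZminus blue x y
  Force CCR-ZL     blue x y =
    (x ≢ y × ForceZminus blue x y) ⊎ (x ≡ y × ForceZdot blue x x)

  data Blue (R : Rule) (B : Subset n) : Fin n → Set where
    initial : ∀ {v} → v ∈ B → Blue R B v
    force   : ∀ x y → Force R (Blue R B) x y → Blue R B y

  IsZeroForcingSet : Rule → Subset n → Set
  IsZeroForcingSet R B = ∀ v → Blue R B v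

  IsMinZF : Rule → ℕ → Set
  IsMinZF R z =
    (∃ λ B → IsZeroForcingSet R B × ∣ B ∣ ≡ z) ×
    (∀ B → IsZeroForcingSet R B → z ≤ ∣ B ∣)

  -- Each kind specifies which neighbourhood of the new
  -- vertex v_i (open/closed) must contain a vertex outside the union
  -- of which neighbourhoods (open/closed) of the earlier vertices.
  data SeqKind : Set where
    Zseq domseq totseq Lseq : SeqKind

  NewNbhd PrevNbhd : SeqKind → Fin n → Fin n → Set
  NewNbhd Zseq   = N⟮_⟯
  NewNbhd domseq = N[_]
  NewNbhd totseq = N⟮_⟯
  NewNbhd Lseq   = N[_]
  PrevNbhd Zseq   = N[_]
  PrevNbhd domseq = N[_]
  PrevNbhd totseq = N⟮_⟯
  PrevNbhd Lseq   = N⟮_⟯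

  -- ValidFrom k prev vs : vs continues a sequence whose earlier
  -- vertices are `prev`; elements distinct and each adds a new vertex.
  ValidFrom : SeqKind → List (Fin n) → List (Fin n) → Set
  ValidFrom k prev [] = ⊤
  ValidFrom k prev (v ∷ vs) =
    v ∉ₗ prev ×
    (∃ λ u → NewNbhd k v u × (∀ w → w ∈ₗ prev → ¬ PrevNbhd k w u)) ×
    ValidFrom k (v ∷ prev) vs

  IsSeq : SeqKind → List (Fin n) → Set
  IsSeq k vs = ValidFrom k [] vs

  IsMaxSeq : SeqKind → ℕ → Set
  IsMaxSeq k g =
    (∃ λ vs → IsSeq k vs × length vs ≡ g) ×
    (∀ vs → IsSeq k vs → length vs ≤ g)

module Submission where

open import Defs
open import Data.Nat using (ℕ; _∸_)
open import Data.Product using (_×_)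
open import Relation.Binary.PropositionalEquality using (_≡_)

open import Data.Nat using (suc; _+_; _≤_; s≤s)
import Data.Nat.Properties as ℕ
open import Data.Bool using (true)
open import Data.Bool.Properties using () renaming (_≟_ to _≟ᵇ_)
open import Data.Fin using (Fin; zero; suc; _≟_)
open import Data.Fin.Properties using (any?; all?)
open import Data.Fin.Subset using (Subset; inside; outside; ⁅_⁆; _∪_; ∁; ⊥; ∣_∣; _∈_; _∉_)
  renaming (⊤ to ⊤ₛ)
import Data.Fin.Subset.Properties as Sub
open import Data.Vec using (_∷_)
import Data.Vec as Vec
open import Data.List using (List; []; _∷_; length; map)
open import Data.List.Properties using (length-map)
open import Data.List.Membership.Propositional using () renaming (_∈_ to _∈ₗ_; _∉_ to _∉ₗ_)
import Data.List.Membership.DecPropositional as DecMembership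
open import Data.List.Relation.Unary.Any using (here; there)
open import Data.List.Relation.Unary.All using (All; []; _∷_; lookup)
import Data.List.Relation.Unary.All as All
open import Data.List.Relation.Unary.All.Properties using (All¬⇒¬Any)
open import Data.List.Relation.Unary.AllPairs using ([]; _∷_)
open import Data.List.Relation.Unary.Unique.Propositional using (Unique)
open import Data.Product using (∃; ∃₂; _,_; proj₂)
open import Data.Sum using (_⊎_; inj₁; inj₂)
import Data.Sum as Sum
open import Data.Unit using (⊤; tt)
open import Function using (_∘_; id)
open import Relation.Nullary using (¬_; Dec; yes; no; contradiction)
open import Relation.Nullary.Decidable using (_×-dec_; _⊎-dec_; _→-dec_; ¬?; decidable-stable)
open import Relation.Binary.PropositionalEquality using (_≢_; refl; trans; cong)
import Relation.Binary.PropositionalEquality as ≡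

-- Each rule R is the instance of one uniform rule "ForceBy k": x forces y
-- when y lies in the new-neighbourhood New_k(x) and every other vertex of the
-- previous-neighbourhood Prev_k(x) is blue, where (New_k, Prev_k) are the two
-- neighbourhoods defining the sequence kind k matching R.  Both neighbourhoods
-- are symmetric and decidable, and the blue closure of B is the least set
-- containing B and closed under ForceBy k.  The theorem is then two bounds:
--  * (z ≤ n - g) the vertices off a k-sequence form a zero forcing set, since
--    read backwards each v_i is forced by the vertex u_i witnessing its step;
--  * (n - z ≤ g) the vertices forced from a minimum zero forcing set, listed
--    from the last forced to the first, form a k-sequence.

insertAll : ∀ {n} → List (Fin n) → Subset n → Subset n
insertAll []       p = p
insertAll (v ∷ vs) p = ⁅ v ⁆ ∪ insertAll vs p

∈-insertAll⁻ : ∀ {n} {w : Fin n} vs p → w ∈ insertAll vs p → w ∈ₗ vs ⊎ w ∈ p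
∈-insertAll⁻ []       p w∈p = inj₂ w∈p
∈-insertAll⁻ (v ∷ vs) p w∈ with Sub.x∈p∪q⁻ ⁅ v ⁆ (insertAll vs p) w∈
... | inj₁ w∈⁅v⁆  = inj₁ (here (Sub.x∈⁅y⁆⇒x≡y v w∈⁅v⁆))
... | inj₂ w∈rest = Sum.map₁ there (∈-insertAll⁻ vs p w∈rest)

∈-insertAll⁺ : ∀ {n} {w : Fin n} vs p → w ∈ₗ vs ⊎ w ∈ p → w ∈ insertAll vs p
∈-insertAll⁺ []       p (inj₂ w∈p)          = w∈p
∈-insertAll⁺ (v ∷ vs) p (inj₁ (here refl))  = Sub.x∈p∪q⁺ (inj₁ (Sub.x∈⁅x⁆ v))
∈-insertAll⁺ (v ∷ vs) p (inj₁ (there w∈vs)) = Sub.x∈p∪q⁺ (inj₂ (∈-insertAll⁺ vs p (inj₁ w∈vs)))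
∈-insertAll⁺ (v ∷ vs) p (inj₂ w∈p)          = Sub.x∈p∪q⁺ (inj₂ (∈-insertAll⁺ vs p (inj₂ w∈p)))

∣⁅x⁆∪p∣≤1+∣p∣ : ∀ {n} (x : Fin n) (p : Subset n) → ∣ ⁅ x ⁆ ∪ p ∣ ≤ suc ∣ p ∣
∣⁅x⁆∪p∣≤1+∣p∣ zero    (s ∷ p)       =
  s≤s (ℕ.≤-trans (ℕ.≤-reflexive (cong ∣_∣ (Sub.∪-identityˡ p))) (Sub.∣p∣≤∣x∷p∣ s p))
∣⁅x⁆∪p∣≤1+∣p∣ (suc x) (outside ∷ p) = ∣⁅x⁆∪p∣≤1+∣p∣ x p
∣⁅x⁆∪p∣≤1+∣p∣ (suc x) (inside ∷ p)  = s≤s (∣⁅x⁆∪p∣≤1+∣p∣ x p)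

∣⁅x⁆∪p∣≡1+∣p∣ : ∀ {n} (x : Fin n) (p : Subset n) → x ∉ p → ∣ ⁅ x ⁆ ∪ p ∣ ≡ suc ∣ p ∣
∣⁅x⁆∪p∣≡1+∣p∣ zero    (outside ∷ p) _   = cong (suc ∘ ∣_∣) (Sub.∪-identityˡ p)
∣⁅x⁆∪p∣≡1+∣p∣ zero    (inside ∷ p)  x∉p = contradiction Vec.here x∉p
∣⁅x⁆∪p∣≡1+∣p∣ (suc x) (outside ∷ p) x∉p = ∣⁅x⁆∪p∣≡1+∣p∣ x p (x∉p ∘ Vec.there)
∣⁅x⁆∪p∣≡1+∣p∣ (suc x) (inside ∷ p)  x∉p = cong suc (∣⁅x⁆∪p∣≡1+∣p∣ x p (x∉p ∘ Vec.there))

∣insertAll∣≤ : ∀ {n} (vs : List (Fin n)) p → ∣ insertAll vs p ∣ ≤ length vs + ∣ p ∣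
∣insertAll∣≤ []       p = ℕ.≤-refl
∣insertAll∣≤ (v ∷ vs) p = ℕ.≤-trans (∣⁅x⁆∪p∣≤1+∣p∣ v _) (s≤s (∣insertAll∣≤ vs p))

∣insertAll-unique∣ : ∀ {n} {vs : List (Fin n)} → Unique vs → ∣ insertAll vs ⊥ ∣ ≡ length vs
∣insertAll-unique∣ {n} {[]}     []               = Sub.∣⊥∣≡0 n
∣insertAll-unique∣ {n} {v ∷ vs} (v≢vs ∷ unique) =
  trans (∣⁅x⁆∪p∣≡1+∣p∣ v _ v∉rest) (cong suc (∣insertAll-unique∣ unique))
  where
  v∉rest : v ∉ insertAll vs ⊥
  v∉rest v∈ with ∈-insertAll⁻ vs ⊥ v∈
  ... | inj₁ v∈vs = All¬⇒¬Any v≢vs v∈vs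
  ... | inj₂ v∈⊥  = Sub.∉⊥ v∈⊥

full-size : ∀ {n} (p : Subset n) → (∀ v → v ∈ p) → n ≤ ∣ p ∣
full-size {n} p all∈p = ℕ.≤-trans (ℕ.≤-reflexive (≡.sym (Sub.∣⊤∣≡n n)))
                                  (Sub.p⊆q⇒∣p∣≤∣q∣ {p = ⊤ₛ} (λ {v} _ → all∈p v))

bounds⇒≡ : ∀ {n z g} → z ≤ n ∸ g → n ∸ z ≤ g → z ≡ n ∸ g
bounds⇒≡ {n} {z} {g} z≤n∸g n∸z≤g = ℕ.≤-antisym z≤n∸g (begin
  n ∸ g         ≤⟨ ℕ.∸-monoʳ-≤ n n∸z≤g ⟩
  n ∸ (n ∸ z)   ≡⟨ ℕ.m∸[m∸n]≡n (ℕ.≤-trans z≤n∸g (ℕ.m∸n≤m n g)) ⟩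
  z             ∎)
  where open ℕ.≤-Reasoning

module _ {n : ℕ} (G : Graph n) where

  open-sym : ∀ {x y} → N⟮_⟯ G x y → N⟮_⟯ G y x
  open-sym {x} {y} x~y = trans (sym G y x) x~y

  closed-sym : ∀ {x y} → N[_] G x y → N[_] G y x
  closed-sym (inj₁ y≡x) = inj₁ (≡.sym y≡x)
  closed-sym (inj₂ x~y) = inj₂ (open-sym x~y)

  open? : ∀ x y → Dec (N⟮_⟯ G x y)
  open? x y = adj G x y ≟ᵇ true

  closed? : ∀ x y → Dec (N[_] G x y)
  closed? x y = (y ≟ x) ⊎-dec open? x y

  New-sym : ∀ k {x y} → NewNbhd G k x y → NewNbhd G k y x
  New-sym Zseq   = open-sym
  New-sym domseq = closed-sym
  New-sym totseq = open-sym
  New-sym Lseq   = closed-sym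

  Prev-sym : ∀ k {x y} → PrevNbhd G k x y → PrevNbhd G k y x
  Prev-sym Zseq   = closed-sym
  Prev-sym domseq = closed-sym
  Prev-sym totseq = open-sym
  Prev-sym Lseq   = open-sym

  New? : ∀ k x y → Dec (NewNbhd G k x y)
  New? Zseq   = open?
  New? domseq = closed?
  New? totseq = open?
  New? Lseq   = closed?

  Prev? : ∀ k x y → Dec (PrevNbhd G k x y)
  Prev? Zseq   = closed?
  Prev? domseq = closed?
  Prev? totseq = open?
  Prev? Lseq   = open?

  ForceBy : SeqKind G → (Fin n → Set) → Fin n → Fin n → Set
  ForceBy k Q x y = NewNbhd G k x y × (∀ w → PrevNbhd G k x w → w ≢ y → Q w)

  ForceBy? : ∀ k {Q : Fin n → Set} → (∀ w → Dec (Q w)) → ∀ x y → Dec (ForceBy k Q x y)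
  ForceBy? k Q? x y = New? k x y ×-dec all? (λ w → Prev? k x w →-dec ¬? (w ≟ y) →-dec Q? w)

  kindOf : Rule G → SeqKind G
  kindOf CCR-Z      = Zseq
  kindOf CCR-Zdot   = domseq
  kindOf CCR-Zminus = totseq
  kindOf CCR-ZL     = Lseq

  -- For CCR-Z, CCR-Zdot and
  -- CCR-Zminus the two notions coincide; for CCR-ZL a force x → x is the
  -- self-force of CCR-Zdot and any other one is a CCR-Zminus force.
  force-from : ∀ R {Q x y} → ForceBy (kindOf R) Q x y → Force G R Q x y
  force-from CCR-Z      f = f
  force-from CCR-Zdot   f = f
  force-from CCR-Zminus f = f
  force-from CCR-ZL {Q} {x} {y} (y∈N[x] , others) with x ≟ y
  ... | yes refl = inj₂ (refl , inj₁ refl , others′)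
    where
    others′ : ∀ w → N[_] G x w → w ≢ x → Q w
    others′ w (inj₁ w≡x) w≢x = contradiction w≡x w≢x
    others′ w (inj₂ x~w) w≢x = others w x~w w≢x
  ... | no x≢y = inj₁ (x≢y , x~y y∈N[x] , others)
    where
    x~y : N[_] G x y → N⟮_⟯ G x y
    x~y (inj₁ y≡x) = contradiction (≡.sym y≡x) x≢y
    x~y (inj₂ x~y) = x~y

  blue-closed : ∀ R {B x y} → ForceBy (kindOf R) (Blue G R B) x y → Blue G R B y
  blue-closed R f = force _ _ (force-from R f)

  blue-least : ∀ R {B} {Q : Fin n → Set} → (∀ {v} → v ∈ B → Q v) →
               (∀ x y → ForceBy (kindOf R) Q x y → Q y) → ∀ {v} → Blue G R B v → Q v
  blue-least R B⊆Q closed (initial v∈B) = B⊆Q v∈B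
  blue-least CCR-Z B⊆Q closed (force x y (y∈N , others)) =
    closed x y (y∈N , λ w w∈N w≢y → blue-least CCR-Z B⊆Q closed (others w w∈N w≢y))
  blue-least CCR-Zdot B⊆Q closed (force x y (y∈N , others)) =
    closed x y (y∈N , λ w w∈N w≢y → blue-least CCR-Zdot B⊆Q closed (others w w∈N w≢y))
  blue-least CCR-Zminus B⊆Q closed (force x y (y∈N , others)) =
    closed x y (y∈N , λ w w∈N w≢y → blue-least CCR-Zminus B⊆Q closed (others w w∈N w≢y))
  blue-least CCR-ZL B⊆Q closed (force x y (inj₁ (_ , x~y , others))) =
    closed x y (inj₂ x~y , λ w x~w w≢y → blue-least CCR-ZL B⊆Q closed (others w x~w w≢y))
  blue-least CCR-ZL B⊆Q closed (force x y (inj₂ (refl , _ , others))) =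
    closed x x (inj₁ refl , λ w x~w w≢x → blue-least CCR-ZL B⊆Q closed (others w (inj₂ x~w) w≢x))

  stalled-force : ∀ R {B} {Q : Fin n → Set} → (∀ w → Dec (Q w)) → (∀ {v} → v ∈ B → Q v) →
                  ∀ {v} → Blue G R B v → ¬ Q v → ∃₂ λ x y → ¬ Q y × ForceBy (kindOf R) Q x y
  stalled-force R {Q = Q} Q? B⊆Q v-blue ¬Qv
    with any? (λ x → any? (λ y → ¬? (Q? y) ×-dec ForceBy? (kindOf R) Q? x y))
  ... | yes (x , y , step) = x , y , step
  ... | no no-step = contradiction (blue-least R B⊆Q closed v-blue) ¬Qv
    where
    closed : ∀ x y → ForceBy (kindOf R) Q x y → Q y
    closed x y f = decidable-stable (Q? y) (λ ¬Qy → no-step (x , y , ¬Qy , f))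

  -- First bound, z ≤ n - g.  Read backwards, a k-sequence can be forced:
  -- its witness u_i has v_i as new-neighbour, and no earlier v_j lies in the
  -- previous-neighbourhood of u_i.
  sequence-forced : ∀ k {Q : Fin n → Set} → (∀ x y → ForceBy k Q x y → Q y) →
                    ∀ prev vs → ValidFrom G k prev vs →
                    (∀ w → Q w ⊎ w ∈ₗ prev ⊎ w ∈ₗ vs) → All Q vs
  sequence-forced k closed prev []       _ _ = []
  sequence-forced k {Q} closed prev (v ∷ vs) (_ , (u , u∈New , fresh) , rest) cover = Qv ∷ Qvs
    where
    cover′ : ∀ w → Q w ⊎ w ∈ₗ (v ∷ prev) ⊎ w ∈ₗ vs
    cover′ w with cover w
    ... | inj₁ Qw                  = inj₁ Qw
    ... | inj₂ (inj₁ w∈prev)        = inj₂ (inj₁ (there w∈prev))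
    ... | inj₂ (inj₂ (here w≡v))    = inj₂ (inj₁ (here w≡v))
    ... | inj₂ (inj₂ (there w∈vs))  = inj₂ (inj₂ w∈vs)

    Qvs : All Q vs
    Qvs = sequence-forced k closed (v ∷ prev) vs rest cover′

    others : ∀ w → PrevNbhd G k u w → w ≢ v → Q w
    others w w∈Prev w≢v with cover w
    ... | inj₁ Qw                  = Qw
    ... | inj₂ (inj₁ w∈prev)        = contradiction (Prev-sym k w∈Prev) (fresh w w∈prev)
    ... | inj₂ (inj₂ (here w≡v))    = contradiction w≡v w≢v
    ... | inj₂ (inj₂ (there w∈vs))  = lookup Qvs w∈vs

    Qv : Q v
    Qv = closed u v (New-sym k u∈New , others)

  valid-avoids : ∀ k prev vs → ValidFrom G k prev vs → All (_∉ₗ prev) vs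
  valid-avoids k prev []       _                = []
  valid-avoids k prev (v ∷ vs) (v∉prev , _ , rest) =
    v∉prev ∷ All.map (_∘ there) (valid-avoids k (v ∷ prev) vs rest)

  valid-unique : ∀ k prev vs → ValidFrom G k prev vs → Unique vs
  valid-unique k prev []       _              = []
  valid-unique k prev (v ∷ vs) (_ , _ , rest) =
    All.map (λ w∉ v≡w → w∉ (here (≡.sym v≡w))) (valid-avoids k (v ∷ prev) vs rest)
      ∷ valid-unique k (v ∷ prev) vs rest

  complement-forcing : ∀ R vs → IsSeq G (kindOf R) vs → IsZeroForcingSet G R (∁ (insertAll vs ⊥))
  complement-forcing R vs seq w = Sum.[ id , Sum.[ (λ ()) , lookup vs-blue ] ] (cover w)
    where
    cover : ∀ w → Blue G R (∁ (insertAll vs ⊥)) w ⊎ w ∈ₗ [] ⊎ w ∈ₗ vs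
    cover w with w Sub.∈? insertAll vs ⊥
    ... | no w∉  = inj₁ (initial (Sub.x∉p⇒x∈∁p w∉))
    ... | yes w∈ = Sum.[ inj₂ ∘ inj₂ , (λ w∈⊥ → contradiction w∈⊥ Sub.∉⊥) ] (∈-insertAll⁻ vs ⊥ w∈)

    vs-blue : All (Blue G R (∁ (insertAll vs ⊥))) vs
    vs-blue = sequence-forced (kindOf R) (λ _ _ → blue-closed R) [] vs seq cover

  zero-forcing-upper-bound : ∀ R {z g} → IsMinZF G R z → IsMaxSeq G (kindOf R) g → z ≤ n ∸ g
  zero-forcing-upper-bound R {z} (_ , minimal) ((vs , seq , refl) , _) = begin
    z                            ≤⟨ minimal _ (complement-forcing R vs seq) ⟩
    ∣ ∁ (insertAll vs ⊥) ∣       ≡⟨ Sub.∣∁p∣≡n∸∣p∣ (insertAll vs ⊥) ⟩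
    n ∸ ∣ insertAll vs ⊥ ∣       ≡⟨ cong (n ∸_) (∣insertAll-unique∣ (valid-unique (kindOf R) [] vs seq)) ⟩
    n ∸ length vs                ∎
    where open ℕ.≤-Reasoning

  -- Second bound, n - z ≤ g.  Run the forcing process from a zero forcing
  -- set B and record each force; the forced vertices, last one first, form a
  -- sequence of the matching kind.
  module Chronologies (R : Rule G) (B : Subset n) where

    -- A record of forces (x , y), latest first.
    Forces : Set
    Forces = List (Fin n × Fin n)

    forced : Forces → List (Fin n)
    forced = map proj₂

    Covered : Forces → Fin n → Set
    Covered S w = w ∈ B ⊎ w ∈ₗ forced S

    covered? : ∀ S w → Dec (Covered S w)
    covered? S w = (w Sub.∈? B) ⊎-dec (w ∈? forced S)
      where open DecMembership _≟_

    Chronology : Forces → Set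
    Chronology []            = ⊤
    Chronology ((x , y) ∷ S) = Chronology S × ¬ Covered S y × ForceBy (kindOf R) (Covered S) x y

    run : IsZeroForcingSet G R B → ∀ f S → Chronology S →
          ∃ λ S′ → Chronology S′ × ((∀ v → Covered S′ v) ⊎ f + length S ≤ length S′)
    run zf 0       S chron = S , chron , inj₂ ℕ.≤-refl
    run zf (suc f) S chron with any? (λ v → ¬? (covered? S v))
    ... | no none-uncovered =
      S , chron , inj₁ (λ v → decidable-stable (covered? S v) (λ ¬Cv → none-uncovered (v , ¬Cv)))
    ... | yes (v , ¬Cv) with stalled-force R (covered? S) inj₁ (zf v) ¬Cv
    ... | x , y , ¬Cy , x→y with run zf f ((x , y) ∷ S) (chron , ¬Cy , x→y)
    ... | S′ , chron′ , inj₁ all-covered = S′ , chron′ , inj₁ all-covered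
    ... | S′ , chron′ , inj₂ longer      =
      S′ , chron′ , inj₂ (ℕ.≤-trans (ℕ.≤-reflexive (≡.sym (ℕ.+-suc f (length S)))) longer)

    -- Listed latest first, the forced vertices form a sequence: x witnesses
    -- the step of y, and every vertex forced after y was uncovered when x
    -- forced y, so it is not a previous-neighbour of x.
    chronology-sequence : ∀ prev S → Chronology S → (∀ w → w ∈ₗ prev → ¬ Covered S w) →
                          ValidFrom G (kindOf R) prev (forced S)
    chronology-sequence prev []            _                       _         = tt
    chronology-sequence prev ((x , y) ∷ S) (chron , ¬Cy , y∈New , others) uncovered =
      (λ y∈prev → uncovered y y∈prev (inj₂ (here refl))) ,
      (x , New-sym (kindOf R) y∈New , x∉Prev) ,
      chronology-sequence (y ∷ prev) S chron uncovered′
      where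
      later : ∀ {w} → Covered S w → Covered ((x , y) ∷ S) w
      later = Sum.map₂ there

      x∉Prev : ∀ w → w ∈ₗ prev → ¬ PrevNbhd G (kindOf R) w x
      x∉Prev w w∈prev x∈Prev = uncovered w w∈prev
        (later (others w (Prev-sym (kindOf R) x∈Prev) (λ w≡y → uncovered w w∈prev (inj₂ (here w≡y)))))

      uncovered′ : ∀ w → w ∈ₗ (y ∷ prev) → ¬ Covered S w
      uncovered′ w (here refl)    = ¬Cy
      uncovered′ w (there w∈prev) = uncovered w w∈prev ∘ later

    forced-bound : ∀ {S} → (∀ v → Covered S v) ⊎ n + 0 ≤ length S → n ∸ ∣ B ∣ ≤ length S
    forced-bound (inj₂ n≤) = ℕ.≤-trans (ℕ.m∸n≤m n ∣ B ∣) (ℕ.≤-trans (ℕ.m≤m+n n 0) n≤)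
    forced-bound {S} (inj₁ all-covered) = ℕ.m≤n+o⇒m∸n≤o n ∣ B ∣ (begin
      n                               ≤⟨ full-size _ (λ v → ∈-insertAll⁺ (forced S) B (Sum.swap (all-covered v))) ⟩
      ∣ insertAll (forced S) B ∣      ≤⟨ ∣insertAll∣≤ (forced S) B ⟩
      length (forced S) + ∣ B ∣       ≡⟨ ℕ.+-comm _ ∣ B ∣ ⟩
      ∣ B ∣ + length (forced S)       ≡⟨ cong (∣ B ∣ +_) (length-map proj₂ S) ⟩
      ∣ B ∣ + length S                ∎)
      where open ℕ.≤-Reasoning

    long-sequence : IsZeroForcingSet G R B → ∃ λ vs → IsSeq G (kindOf R) vs × n ∸ ∣ B ∣ ≤ length vs
    long-sequence zf with run zf n [] tt
    ... | S , chron , outcome =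
      forced S ,
      chronology-sequence [] S chron (λ _ ()) ,
      ℕ.≤-trans (forced-bound outcome) (ℕ.≤-reflexive (≡.sym (length-map proj₂ S)))

  sequence-lower-bound : ∀ R {z g} → IsMinZF G R z → IsMaxSeq G (kindOf R) g → n ∸ z ≤ g
  sequence-lower-bound R ((B , zf , refl) , _) (_ , maximal) =
    let (vs , seq , long) = Chronologies.long-sequence R B zf
    in  ℕ.≤-trans long (maximal vs seq)

  zero-forcing≡n∸sequence : ∀ R z g → IsMinZF G R z → IsMaxSeq G (kindOf R) g → z ≡ n ∸ g
  zero-forcing≡n∸sequence R z g min-z max-g =
    bounds⇒≡ (zero-forcing-upper-bound R min-z max-g) (sequence-lower-bound R min-z max-g)

theorem2p2 : ∀ (n : ℕ) (G : Graph n) →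
    (∀ z g → IsMinZF G CCR-Z z → IsMaxSeq G Zseq g → z ≡ n ∸ g) ×
    (∀ z g → IsMinZF G CCR-Zdot z → IsMaxSeq G domseq g → z ≡ n ∸ g) ×
    (∀ z g → IsMinZF G CCR-Zminus z → IsMaxSeq G totseq g → z ≡ n ∸ g) ×
    (∀ z g → IsMinZF G CCR-ZL z → IsMaxSeq G Lseq g → z ≡ n ∸ g)
theorem2p2 n G =
  zero-forcing≡n∸sequence G CCR-Z ,
  zero-forcing≡n∸sequence G CCR-Zdot ,
  zero-forcing≡n∸sequence G CCR-Zminus ,
  zero-forcing≡n∸sequence G CCR-ZL
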